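{- Let $p$ be a prime, $R\ge1$, $V=\mathbb{F}_{p^R}$, $V^*=V\setminus\{0\}$, and let $G_0=\langle\widehat{\omega}^d,\widehat{\omega}^e\alpha^s\rangle\le\Gamma L(1,p^R)$ be in standard form. Then $G_0$ is transitive on $V^*$ if and only if either $d=1$ (so $e=0$), or both of the following hold: (1) $e>0$ and $d$ divides $e\frac{p^{ds}-1}{p^s-1}$; (2) for every $d'$ with $1<d'<d$, $d$ does not divide $e\frac{p^{d's}-1}{p^s-1}$.
   Context: $\omega$ is a fixed primitive element of $\mathbb{F}_{p^R}$, $\widehat{\omega}$ is the map $x\mapsto x\omega$ and $\alpha$ the Frobenius map $x\mapsto x^p$; $\Gamma L(1,p^R)=\langle\widehat{\omega},\alpha\rangle$, maps acting on the right. A subgroup $\langle\widehat{\omega}^d,\widehat{\omega}^e\alpha^s\rangle$ is in standard form if $d>0$ and $d\mid p^R-1$; $s>0$ and $s\mid R$; and $0\le e<d$ with $e(p^R-1)/(p^s-1)\equiv0\pmod d$. -}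

module Defs where

open import Level using (0ℓ)
open import Data.Nat using (ℕ; zero; suc; _/_; _∸_; _^_)
open import Data.Fin using (Fin)
open import Data.Product using (∃)
open import Relation.Binary.PropositionalEquality using (_≡_; _≢_)
import Algebra.Structures
open import Function.Bundles using (_↔_)

iter : {A : Set} → (A → A) → ℕ → A → A
iter f zero    x = x
iter f (suc n) x = iter f n (f x)

-- total exact-division helper on ℕ: a / b for b ≠ 0 (used only with b = p^s - 1 ≥ 1)
_div_ : ℕ → ℕ → ℕ
a div zero    = 0
a div (suc b) = a / suc b

record FiniteField (q : ℕ) : Set₁ where
  infixl 7 _*_
  infixl 6 _+_
  field
    F   : Set
    0# 1# : F
    _+_ _*_ : F → F → F
    -_  : F → F
    isCommutativeRing : Algebra.Structures.IsCommutativeRing {A = F} _≡_ _+_ _*_ -_ 0# 1#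
    0≢1 : 0# ≢ 1#
    inverse : ∀ x → x ≢ 0# → ∃ λ y → x * y ≡ 1#
    card : F ↔ Fin q

  pow : F → ℕ → F
  pow x zero    = 1#
  pow x (suc n) = x * pow x n

module GammaL {q : ℕ} (K : FiniteField q) (p : ℕ) (ω : FiniteField.F K) where
  open FiniteField K

  IsPrimitive : Set
  IsPrimitive = ∀ x → x ≢ 0# → ∃ λ i → x ≡ pow ω i

  ω̂ : F → F
  ω̂ x = x * ω

  α : F → F
  α x = pow x p

  -- maps act on the right: x (ω̂^e α^s) = (x ω̂^e) α^s
  gen₁ : ℕ → F → F
  gen₁ d = iter ω̂ d

  gen₂ : ℕ → ℕ → F → F
  gen₂ e s x = iter α s (iter ω̂ e x)

  -- y lies in the orbit of x under the group generated by the bijections g and h: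
  -- the equivalence closure of the steps z ↦ z g and z ↦ z h.
  data Orbit (g h : F → F) (x : F) : F → Set where
    here  : Orbit g h x x
    fwd₁  : ∀ {y} → Orbit g h x y → Orbit g h x (g y)
    fwd₂  : ∀ {y} → Orbit g h x y → Orbit g h x (h y)
    bwd₁  : ∀ {y} → Orbit g h x (g y) → Orbit g h x y
    bwd₂  : ∀ {y} → Orbit g h x (h y) → Orbit g h x y

  TransitiveOnV* : ℕ → ℕ → ℕ → Set
  TransitiveOnV* d e s =
    ∀ x y → x ≢ 0# → y ≢ 0# → Orbit (gen₁ d) (gen₂ e s) x y

-- Every nonzero element is a power ω^a, with a determined modulo N = p^R − 1. On exponents
-- ω̂^d acts as a ↦ a + d and ω̂^e α^s as the affine map a ↦ (a + e) p^s. Since d ∣ N, both maps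
-- act on residues modulo d: the first trivially, the second as a permutation f, because p^s
-- is a unit modulo d (p^s p^(R−s) = N + 1). So the orbit of ω^a under G₀ consists of the powers
-- whose exponent lies in the ⟨f⟩-orbit of a modulo d, and G₀ is transitive on V* iff the
-- ⟨f⟩-orbit of 0 is all of ℤ/d, i.e. iff 0 first returns to itself after exactly d steps.
-- Finally f^t(0) = e p^s (p^(ts) − 1)/(p^s − 1) and p^s can be cancelled, so f^t(0) ≡ 0
-- (mod d) iff d divides e (p^(ts) − 1)/(p^s − 1); for t = 1 this reads d ∣ e, i.e. e = 0.

module Submission where

open import Defs
open import Data.Nat using (ℕ; _*_; _∸_; _^_; _<_; _≤_)
open import Data.Nat.Divisibility using (_∣_)
open import Data.Nat.Primality using (Prime)
open import Data.Product using (_×_)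
open import Data.Sum using (_⊎_)
open import Relation.Binary.PropositionalEquality using (_≡_)
open import Relation.Nullary using (¬_)
open import Function.Bundles using (_⇔_)

open import Data.Nat
  using (zero; suc; _+_; z≤n; s≤s; z<s; NonZero; >-nonZero; >-nonZero⁻¹; _%_; _/_; _≟_; nonTrivial⇒n>1)
open import Data.Nat.Properties
open import Data.Nat.DivMod
  using (m≡m%n+[m/n]*n; m%n<n; %-distribˡ-+; %-distribˡ-*; %-remove-+ʳ; [m+n]%n≡m%n; m<n⇒m%n≡m;
         m∣n⇒o%n%m≡o%m; m*n/n≡m; _mod_)
open import Data.Nat.Divisibility using (n∣m*n; ∣m⇒∣m*n; ∣n⇒∣m*n; ∣m+n∣m⇒∣n; ∣⇒≤; _∣0)
open import Data.Nat.Primality using (prime⇒nonTrivial)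
open import Data.Nat.Tactic.RingSolver using (solve-∀)
open import Data.Fin using (Fin; toℕ; fromℕ<; punchIn; punchOut)
import Data.Fin.Properties as Finₚ
open import Data.Product using (_,_; proj₁; proj₂; ∃; ∃₂)
open import Data.Sum using (inj₁; inj₂)
open import Function.Base using (_∘_)
open import Function.Bundles using (mk⇔; module Equivalence; Inverse; _↔_)
open import Function.Definitions using (Injective)
import Function.Properties.Equivalence as ⇔
open import Relation.Binary.Definitions using (tri<; tri≈; tri>)
open import Relation.Binary.PropositionalEquality
  using (_≢_; refl; sym; trans; cong; cong₂; subst; module ≡-Reasoning)
open import Relation.Nullary using (yes; no; contradiction)
import Algebra.Structures

iter-+ : {A : Set} (f : A → A) (m n : ℕ) (x : A) → iter f (m + n) x ≡ iter f n (iter f m x)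
iter-+ f zero    n x = refl
iter-+ f (suc m) n x = iter-+ f m n (f x)

iter-suc : {A : Set} (f : A → A) (n : ℕ) (x : A) → iter f (suc n) x ≡ f (iter f n x)
iter-suc f n x = trans (cong (λ k → iter f k x) (+-comm 1 n)) (iter-+ f n 1 x)

injective⇒surjective : ∀ {n} {f : Fin n → Fin n} → Injective _≡_ _≡_ f →
  ∀ y → ∃ λ x → f x ≡ y
injective⇒surjective {suc n} {f} f-injective y with Finₚ.any? (λ x → f x Finₚ.≟ y)
... | yes hit  = hit
... | no  miss = contradiction (Finₚ.injective⇒≤ punchOut-injective) 1+n≰n
  where
  avoids : ∀ x → y ≢ f x
  avoids x y≡fx = miss (x , sym y≡fx)
  punchOut-injective : Injective _≡_ _≡_ (λ x → punchOut (avoids x))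
  punchOut-injective eq = f-injective (Finₚ.punchOut-injective (avoids _) (avoids _) eq)

module Residue (d : ℕ) {{_ : NonZero d}} where

  infix 4 _≋_
  _≋_ : ℕ → ℕ → Set
  a ≋ b = a % d ≡ b % d

  ≋⇒∣∸ : ∀ {a b} → a ≋ b → d ∣ b ∸ a
  ≋⇒∣∸ {a} {b} a≋b = subst (d ∣_) (sym difference) (n∣m*n (b / d ∸ a / d))
    where
    open ≡-Reasoning
    difference : b ∸ a ≡ (b / d ∸ a / d) * d
    difference = begin
      b ∸ a                                     ≡⟨ cong₂ _∸_ (m≡m%n+[m/n]*n b d) a-expanded ⟩
      (b % d + b / d * d) ∸ (b % d + a / d * d) ≡⟨ [m+n]∸[m+o]≡n∸o (b % d) _ _ ⟩
      b / d * d ∸ a / d * d                     ≡⟨ sym (*-distribʳ-∸ d (b / d) (a / d)) ⟩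
      (b / d ∸ a / d) * d                       ∎
      where
      a-expanded : a ≡ b % d + a / d * d
      a-expanded = trans (m≡m%n+[m/n]*n a d) (cong (_+ a / d * d) a≋b)

  ∣∸⇒≋ : ∀ {a b} → a ≤ b → d ∣ b ∸ a → a ≋ b
  ∣∸⇒≋ {a} {b} a≤b d∣b∸a = trans (sym (%-remove-+ʳ a d∣b∸a)) (cong (_% d) (m+[n∸m]≡n a≤b))

  ∣⇒≋0 : ∀ {a} → d ∣ a → a ≋ 0
  ∣⇒≋0 d∣a = sym (∣∸⇒≋ z≤n d∣a)

  ≋0⇒∣ : ∀ {a} → a ≋ 0 → d ∣ a
  ≋0⇒∣ = ≋⇒∣∸ ∘ sym

  ≋-+ʳ : ∀ c {a b} → a ≋ b → a + c ≋ b + c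
  ≋-+ʳ c {a} {b} a≋b =
    trans (%-distribˡ-+ a c d) (trans (cong (λ r → (r + c % d) % d) a≋b) (sym (%-distribˡ-+ b c d)))

  ≋-*ʳ : ∀ c {a b} → a ≋ b → a * c ≋ b * c
  ≋-*ʳ c {a} {b} a≋b =
    trans (%-distribˡ-* a c d) (trans (cong (λ r → (r * (c % d)) % d) a≋b) (sym (%-distribˡ-* b c d)))

  ≋-reflect : (g : ℕ → ℕ) → (∀ x y → d ∣ g y ∸ g x → d ∣ y ∸ x) →
    ∀ {x y} → g x ≋ g y → x ≋ y
  ≋-reflect g reflects {x} {y} gx≋gy with ≤-total x y
  ... | inj₁ x≤y = ∣∸⇒≋ x≤y (reflects x y (≋⇒∣∸ gx≋gy))
  ... | inj₂ y≤x = sym (∣∸⇒≋ y≤x (reflects y x (≋⇒∣∸ (sym gx≋gy))))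

  <-≋⇒≡ : ∀ {a b} → a < d → b < d → a ≋ b → a ≡ b
  <-≋⇒≡ a<d b<d a≋b = trans (sym (m<n⇒m%n≡m a<d)) (trans a≋b (m<n⇒m%n≡m b<d))

  mod-≡⇒≋ : ∀ {a b} → a mod d ≡ b mod d → a ≋ b
  mod-≡⇒≋ {a} {b} eq =
    trans (sym (Finₚ.toℕ-fromℕ< (m%n<n a d))) (trans (cong toℕ eq) (Finₚ.toℕ-fromℕ< (m%n<n b d)))

  d≡1⇒≋ : d ≡ 1 → ∀ a b → a ≋ b
  d≡1⇒≋ d≡1 a b = trans (residue≡0 a) (sym (residue≡0 b))
    where
    residue≡0 : ∀ a → a % d ≡ 0
    residue≡0 a = n<1⇒n≡0 (subst (a % d <_) d≡1 (m%n<n a d))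

  module ResidueMap (f : ℕ → ℕ)
                    (f-cong : ∀ {a b} → a ≋ b → f a ≋ f b)
                    (f-cancel : ∀ {a b} → f a ≋ f b → a ≋ b) where

    iter-cong : ∀ n {a b} → a ≋ b → iter f n a ≋ iter f n b
    iter-cong zero    a≋b = a≋b
    iter-cong (suc n) a≋b = iter-cong n (f-cong a≋b)

    iter-cancel : ∀ n {a b} → iter f n a ≋ iter f n b → a ≋ b
    iter-cancel zero    eq = eq
    iter-cancel (suc n) eq = f-cancel (iter-cancel n eq)

    ReturnsAt : ℕ → Set
    ReturnsAt t = iter f t 0 ≋ 0

    FirstReturnAt : ℕ → Set
    FirstReturnAt t = ReturnsAt t × (∀ u → 0 < u → u < t → ¬ ReturnsAt u)

    -- the residue classes met by the orbit of 0 under the group generated by f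
    Reachable : ℕ → Set
    Reachable c = ∃₂ λ j k → iter f j 0 ≋ iter f k c

    collision⇒returnsAt : ∀ {i j} → i ≤ j → iter f i 0 ≋ iter f j 0 → ReturnsAt (j ∸ i)
    collision⇒returnsAt {i} {j} i≤j eq = sym (iter-cancel i (trans eq (cong (_% d) split)))
      where
      split : iter f j 0 ≡ iter f i (iter f (j ∸ i) 0)
      split = trans (cong (λ n → iter f n 0) (sym (m∸n+n≡m i≤j))) (iter-+ f (j ∸ i) i 0)

    returnsAt-periodic : ∀ {t} → ReturnsAt t → ∀ m n → iter f (m * t + n) 0 ≋ iter f n 0
    returnsAt-periodic ret zero    n = refl
    returnsAt-periodic {t} ret (suc m) n = begin
      iter f (t + m * t + n) 0 % d         ≡⟨ cong (_% d) split ⟩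
      iter f (m * t + n) (iter f t 0) % d ≡⟨ iter-cong (m * t + n) ret ⟩
      iter f (m * t + n) 0 % d             ≡⟨ returnsAt-periodic ret m n ⟩
      iter f n 0 % d                       ∎
      where
      open ≡-Reasoning
      split : iter f (t + m * t + n) 0 ≡ iter f (m * t + n) (iter f t 0)
      split = trans (cong (λ k → iter f k 0) (+-assoc t (m * t) n)) (iter-+ f t (m * t + n) 0)

    reachable-resp : ∀ {a b} → a ≋ b → Reachable a → Reachable b
    reachable-resp a≋b (j , k , eq) = j , k , trans eq (iter-cong k a≋b)

    reachable-step : ∀ {c} → Reachable c → Reachable (f c)
    reachable-step (j , suc k , eq) = j , k , eq
    reachable-step (j , zero , eq)  = suc j , zero , trans (cong (_% d) (iter-suc f j 0)) (f-cong eq)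

    reachable-unstep : ∀ {c} → Reachable (f c) → Reachable c
    reachable-unstep (j , k , eq) = j , suc k , eq

    reachable⇒hit : ∀ {t} → 0 < t → ReturnsAt t →
      ∀ {c} → Reachable c → ∃ λ i → i < t × iter f i 0 ≋ c
    reachable⇒hit {t} t>0 ret {c} (j , k , eq) = r % t , m%n<n r t , trans reduce hit
      where
      instance
        t≢0 : NonZero t
        t≢0 = >-nonZero t>0
      r : ℕ
      r = k * t + j ∸ k
      k≤kt+j : k ≤ k * t + j
      k≤kt+j = ≤-trans (m≤m*n k t) (m≤m+n (k * t) j)
      hit : iter f r 0 ≋ c
      hit = iter-cancel k (begin
        iter f k (iter f r 0) % d   ≡⟨ cong (_% d) (sym (iter-+ f r k 0)) ⟩
        iter f (r + k) 0 % d        ≡⟨ cong (λ n → iter f n 0 % d) (m∸n+n≡m k≤kt+j) ⟩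
        iter f (k * t + j) 0 % d    ≡⟨ returnsAt-periodic ret k j ⟩
        iter f j 0 % d              ≡⟨ eq ⟩
        iter f k c % d              ∎)
        where open ≡-Reasoning
      reduce : iter f (r % t) 0 ≋ iter f r 0
      reduce = sym (trans (cong (λ n → iter f n 0 % d) (trans (m≡m%n+[m/n]*n r t) (+-comm (r % t) _)))
                          (returnsAt-periodic ret (r / t) (r % t)))

    allReachable⇒noEarlyReturn : (∀ c → Reachable c) →
      ∀ t → 0 < t → t < d → ¬ ReturnsAt t
    allReachable⇒noEarlyReturn reach t t>0 t<d ret = <⇒≱ t<d (Finₚ.injective⇒≤ hitIndex-injective)
      where
      hitOf : (c : Fin d) → ∃ λ i → i < t × iter f i 0 ≋ toℕ c
      hitOf c = reachable⇒hit t>0 ret (reach (toℕ c))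
      -- all d residues would be among the t values f^i(0), i < t
      hitIndex : Fin d → Fin t
      hitIndex c = fromℕ< (proj₁ (proj₂ (hitOf c)))
      hitIndex-injective : Injective _≡_ _≡_ hitIndex
      hitIndex-injective {c} {c′} eq = Finₚ.toℕ-injective (<-≋⇒≡ (Finₚ.toℕ<n c) (Finₚ.toℕ<n c′)
        (trans (sym (proj₂ (proj₂ (hitOf c))))
          (trans (cong (λ i → iter f i 0 % d) (Finₚ.fromℕ<-injective _ _ _ _ eq))
                 (proj₂ (proj₂ (hitOf c′))))))

    module _ (noEarlyReturn : ∀ t → 0 < t → t < d → ¬ ReturnsAt t) where

      noEarlyReturn⇒hit : ∀ c → ∃ λ i → i < d × iter f i 0 ≋ c
      noEarlyReturn⇒hit c =
        let i , eq = injective⇒surjective orbit-injective (c mod d) in toℕ i , Finₚ.toℕ<n i , mod-≡⇒≋ eq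
        where
        orbit : Fin d → Fin d
        orbit i = iter f (toℕ i) 0 mod d
        distinct : ∀ {i j} → i < j → j < d → ¬ iter f i 0 ≋ iter f j 0
        distinct {i} {j} i<j j<d eq = noEarlyReturn (j ∸ i) (m<n⇒0<n∸m i<j) (≤-<-trans (m∸n≤m j i) j<d)
                                (collision⇒returnsAt (<⇒≤ i<j) eq)
        orbit-injective : Injective _≡_ _≡_ orbit
        orbit-injective {i} {j} eq with <-cmp (toℕ i) (toℕ j)
        ... | tri< i<j _ _ = contradiction (mod-≡⇒≋ eq) (distinct i<j (Finₚ.toℕ<n j))
        ... | tri≈ _ i≡j _ = Finₚ.toℕ-injective i≡j
        ... | tri> _ _ j<i = contradiction (sym (mod-≡⇒≋ eq)) (distinct j<i (Finₚ.toℕ<n i))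

      noEarlyReturn⇒returnsAt : ReturnsAt d
      noEarlyReturn⇒returnsAt with noEarlyReturn⇒hit (iter f d 0)
      ... | zero  , _   , eq = sym eq
      ... | suc i , i<d , eq = contradiction (collision⇒returnsAt (<⇒≤ i<d) eq)
                                 (noEarlyReturn _ (m<n⇒0<n∸m i<d) (∸-monoʳ-< z<s (<⇒≤ i<d)))

    allReachable⇒firstReturnAt : (∀ c → Reachable c) → FirstReturnAt d
    allReachable⇒firstReturnAt reach = noEarlyReturn⇒returnsAt early , early
      where
      early : ∀ t → 0 < t → t < d → ¬ ReturnsAt t
      early = allReachable⇒noEarlyReturn reach

geometricSum : ℕ → ℕ → ℕ
geometricSum m zero    = 0
geometricSum m (suc n) = suc (m * geometricSum m n)

geometricSum-1 : ∀ m → geometricSum m 1 ≡ 1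
geometricSum-1 m = cong suc (*-zeroʳ m)

[1+m]^n≡1+m*geometricSum : ∀ m n → suc m ^ n ≡ suc (m * geometricSum (suc m) n)
[1+m]^n≡1+m*geometricSum m zero    = cong suc (sym (*-zeroʳ m))
[1+m]^n≡1+m*geometricSum m (suc n) =
  trans (cong (suc m *_) ([1+m]^n≡1+m*geometricSum m n)) (expand m (geometricSum (suc m) n))
  where
  expand : ∀ m g → suc m * suc (m * g) ≡ suc (m * suc (suc m * g))
  expand = solve-∀

[m^n∸1]div[m∸1]≡geometricSum : ∀ m → 1 < m → ∀ n → (m ^ n ∸ 1) div (m ∸ 1) ≡ geometricSum m n
[m^n∸1]div[m∸1]≡geometricSum (suc zero)    (s≤s ()) n
[m^n∸1]div[m∸1]≡geometricSum (suc (suc m)) _        n = begin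
  (suc (suc m) ^ n ∸ 1) / suc m ≡⟨ cong (λ k → (k ∸ 1) / suc m) ([1+m]^n≡1+m*geometricSum (suc m) n) ⟩
  suc m * g / suc m             ≡⟨ cong (_/ suc m) (*-comm (suc m) g) ⟩
  g * suc m / suc m             ≡⟨ m*n/n≡m g (suc m) ⟩
  g                             ∎
  where
  open ≡-Reasoning
  g : ℕ
  g = geometricSum (suc (suc m)) n

unit-cancel : ∀ {d n P Q x} → d ∣ n → P * Q ≡ suc n → d ∣ x * P → d ∣ x
unit-cancel {d} {n} {P} {Q} {x} d∣n PQ≡1+n d∣xP =
  ∣m+n∣m⇒∣n (subst (d ∣_) expand (∣m⇒∣m*n Q d∣xP)) (∣n⇒∣m*n x d∣n)
  where
  open ≡-Reasoning
  expand : x * P * Q ≡ x * n + x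
  expand = begin
    x * P * Q   ≡⟨ *-assoc x P Q ⟩
    x * (P * Q) ≡⟨ cong (x *_) PQ≡1+n ⟩
    x * suc n   ≡⟨ *-suc x n ⟩
    x + x * n   ≡⟨ +-comm x (x * n) ⟩
    x * n + x   ∎

module AffineResidue (d e p s : ℕ) {{_ : NonZero d}} (1<p^s : 1 < p ^ s)
                     (p^s-cancel : ∀ x → d ∣ x * p ^ s → d ∣ x) where

  open Residue d public

  P : ℕ
  P = p ^ s

  affine : ℕ → ℕ
  affine c = (c + e) * P

  affine-cong : ∀ {a b} → a ≋ b → affine a ≋ affine b
  affine-cong = ≋-*ʳ P ∘ ≋-+ʳ e

  affine-cancel : ∀ {a b} → affine a ≋ affine b → a ≋ b
  affine-cancel =
    ≋-reflect affine λ x y d∣diff → p^s-cancel (y ∸ x) (subst (d ∣_) (difference x y) d∣diff)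
    where
    difference : ∀ x y → affine y ∸ affine x ≡ (y ∸ x) * P
    difference x y = trans (sym (*-distribʳ-∸ P (y + e) (x + e)))
      (cong (_* P) (trans (cong₂ _∸_ (+-comm y e) (+-comm x e)) ([m+n]∸[m+o]≡n∸o e y x)))

  open ResidueMap affine affine-cong affine-cancel public

  iter-affine-0 : ∀ j → iter affine j 0 ≡ e * P * geometricSum P j
  iter-affine-0 zero    = sym (*-zeroʳ (e * P))
  iter-affine-0 (suc j) =
    trans (iter-suc affine j 0) (trans (cong affine (iter-affine-0 j)) (expand e P (geometricSum P j)))
    where
    expand : ∀ e P g → (e * P * g + e) * P ≡ e * P * suc (P * g)
    expand = solve-∀

  returnsAt⇔geometric : ∀ t → ReturnsAt t ⇔ d ∣ e * geometricSum P t
  returnsAt⇔geometric t = mk⇔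
    (λ ret → p^s-cancel _ (subst (d ∣_) (trans (iter-affine-0 t) (swap e P _)) (≋0⇒∣ ret)))
    (λ d∣eG → ∣⇒≋0 (subst (d ∣_) (trans (sym (swap e P _)) (sym (iter-affine-0 t))) (∣m⇒∣m*n P d∣eG)))
    where
    swap : ∀ e P g → e * P * g ≡ e * g * P
    swap = solve-∀

  [p^ts∸1]div[p^s∸1]≡geometricSum : ∀ t → (p ^ (t * s) ∸ 1) div (p ^ s ∸ 1) ≡ geometricSum P t
  [p^ts∸1]div[p^s∸1]≡geometricSum t =
    trans (cong (λ k → (k ∸ 1) div (P ∸ 1)) (trans (cong (p ^_) (*-comm t s)) (sym (^-*-assoc p s t))))
          ([m^n∸1]div[m∸1]≡geometricSum P 1<p^s t)

  returnsAt⇔ : ∀ t → ReturnsAt t ⇔ d ∣ e * ((p ^ (t * s) ∸ 1) div (p ^ s ∸ 1))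
  returnsAt⇔ t = subst (λ g → ReturnsAt t ⇔ d ∣ e * g) (sym ([p^ts∸1]div[p^s∸1]≡geometricSum t))
                       (returnsAt⇔geometric t)

  returnsAt-1⇔ : ReturnsAt 1 ⇔ d ∣ e
  returnsAt-1⇔ = subst (λ n → ReturnsAt 1 ⇔ d ∣ n)
    (trans (cong (e *_) (geometricSum-1 P)) (*-identityʳ e)) (returnsAt⇔geometric 1)

  DivisibilityCondition : Set
  DivisibilityCondition =
    d ≡ 1 ⊎
      ((0 < e × d ∣ (e * ((p ^ (d * s) ∸ 1) div (p ^ s ∸ 1))))
        × (∀ d′ → 1 < d′ → d′ < d → ¬ (d ∣ (e * ((p ^ (d′ * s) ∸ 1) div (p ^ s ∸ 1))))))

  firstReturnAt⇔ : e < d → FirstReturnAt d ⇔ DivisibilityCondition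
  firstReturnAt⇔ e<d = mk⇔ to from
    where
    to : FirstReturnAt d → DivisibilityCondition
    to (ret , early) with d ≟ 1
    ... | yes d≡1 = inj₁ d≡1
    ... | no  d≢1 = inj₂ ((e>0 , Equivalence.to (returnsAt⇔ d) ret) ,
                          λ t 1<t t<d → early t (<-trans z<s 1<t) t<d ∘ Equivalence.from (returnsAt⇔ t))
      where
      1<d : 1 < d
      1<d = ≤∧≢⇒< (>-nonZero⁻¹ d) (d≢1 ∘ sym)
      e>0 : 0 < e
      e>0 = n≢0⇒n>0 λ e≡0 →
        early 1 z<s 1<d (Equivalence.from returnsAt-1⇔ (subst (d ∣_) (sym e≡0) (d ∣0)))
    from : DivisibilityCondition → FirstReturnAt d
    from (inj₁ d≡1) = d≡1⇒≋ d≡1 _ _ , λ u u>0 u<d _ → <⇒≢ u>0 (sym (n<1⇒n≡0 (subst (u <_) d≡1 u<d)))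
    from (inj₂ ((e>0 , d∣) , noSmaller)) = Equivalence.from (returnsAt⇔ d) d∣ , early
      where
      early : ∀ u → 0 < u → u < d → ¬ ReturnsAt u
      early 1 _ _ ret = <⇒≱ e<d (∣⇒≤ {{>-nonZero e>0}} (Equivalence.to returnsAt-1⇔ ret))
      early (suc (suc u)) _ u<d ret =
        noSmaller _ (s≤s (s≤s z≤n)) u<d (Equivalence.to (returnsAt⇔ (suc (suc u))) ret)

module FieldPowers {q : ℕ} (K : FiniteField q) where

  open FiniteField K using (F; 0#; 1#; 0≢1; inverse; card; pow; isCommutativeRing) renaming (_*_ to _·_)
  open Algebra.Structures.IsCommutativeRing isCommutativeRing
    using () renaming (*-assoc to ·-assoc; *-comm to ·-comm; *-identityˡ to ·-identityˡ;
                       *-identityʳ to ·-identityʳ; zeroˡ to ·-zeroˡ; zeroʳ to ·-zeroʳ)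
  open ≡-Reasoning

  pow-+ : ∀ x m n → pow x (m + n) ≡ pow x m · pow x n
  pow-+ x zero    n = sym (·-identityˡ _)
  pow-+ x (suc m) n = trans (cong (x ·_) (pow-+ x m n)) (sym (·-assoc x _ _))

  pow-* : ∀ x m n → pow x (m * n) ≡ pow (pow x m) n
  pow-* x m zero    = cong (pow x) (*-zeroʳ m)
  pow-* x m (suc n) =
    trans (cong (pow x) (*-suc m n)) (trans (pow-+ x m (m * n)) (cong (pow x m ·_) (pow-* x m n)))

  pow-1# : ∀ n → pow 1# n ≡ 1#
  pow-1# zero    = refl
  pow-1# (suc n) = trans (cong (1# ·_) (pow-1# n)) (·-identityˡ 1#)

  pow-periodic : ∀ {x t} → pow x t ≡ 1# → ∀ r m → pow x (r + m * t) ≡ pow x r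
  pow-periodic {x} {t} xᵗ≡1 r m = begin
    pow x (r + m * t)         ≡⟨ pow-+ x r (m * t) ⟩
    pow x r · pow x (m * t)   ≡⟨ cong (λ k → pow x r · pow x k) (*-comm m t) ⟩
    pow x r · pow x (t * m)   ≡⟨ cong (pow x r ·_) (pow-* x t m) ⟩
    pow x r · pow (pow x t) m ≡⟨ cong (λ y → pow x r · pow y m) xᵗ≡1 ⟩
    pow x r · pow 1# m        ≡⟨ cong (pow x r ·_) (pow-1# m) ⟩
    pow x r · 1#              ≡⟨ ·-identityʳ _ ⟩
    pow x r                   ∎

  ·-nonzero : ∀ {x y} → x ≢ 0# → y ≢ 0# → x · y ≢ 0#
  ·-nonzero {x} {y} x≢0 y≢0 xy≡0 with inverse x x≢0
  ... | u , xu≡1 = y≢0 (begin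
    y           ≡⟨ sym (·-identityˡ y) ⟩
    1# · y      ≡⟨ cong (_· y) (trans (sym xu≡1) (·-comm x u)) ⟩
    u · x · y   ≡⟨ ·-assoc u x y ⟩
    u · (x · y) ≡⟨ cong (u ·_) xy≡0 ⟩
    u · 0#      ≡⟨ ·-zeroʳ u ⟩
    0#          ∎)

  pow-nonzero : ∀ {x} → x ≢ 0# → ∀ n → pow x n ≢ 0#
  pow-nonzero x≢0 zero    = 0≢1 ∘ sym
  pow-nonzero x≢0 (suc n) = ·-nonzero x≢0 (pow-nonzero x≢0 n)

  pow-0# : ∀ n → 0 < n → pow 0# n ≡ 0#
  pow-0# (suc n) _ = ·-zeroˡ _

  pow-≡⇒pow-∸≡1 : ∀ {x} → x ≢ 0# → ∀ {m n} → m ≤ n → pow x m ≡ pow x n → pow x (n ∸ m) ≡ 1#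
  pow-≡⇒pow-∸≡1 {x} x≢0 {m} {n} m≤n xᵐ≡xⁿ with inverse (pow x m) (pow-nonzero x≢0 m)
  ... | u , xᵐu≡1 = begin
    pow x (n ∸ m)                 ≡⟨ sym (·-identityˡ _) ⟩
    1# · pow x (n ∸ m)            ≡⟨ cong (_· pow x (n ∸ m)) (trans (sym xᵐu≡1) (·-comm _ u)) ⟩
    u · pow x m · pow x (n ∸ m)   ≡⟨ ·-assoc u _ _ ⟩
    u · (pow x m · pow x (n ∸ m)) ≡⟨ cong (u ·_) (sym (pow-+ x m (n ∸ m))) ⟩
    u · pow x (m + (n ∸ m))       ≡⟨ cong (λ k → u · pow x k) (m+[n∸m]≡n m≤n) ⟩
    u · pow x n                   ≡⟨ cong (u ·_) (sym xᵐ≡xⁿ) ⟩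
    u · pow x m                   ≡⟨ trans (·-comm u _) xᵐu≡1 ⟩
    1#                            ∎

  module Count {N : ℕ} (q≡1+N : q ≡ suc N) where

    card′ : F ↔ Fin (suc N)
    card′ = subst (λ n → F ↔ Fin n) q≡1+N card

    index : F → Fin (suc N)
    index = Inverse.to card′

    index-injective : ∀ {x y} → index x ≡ index y → x ≡ y
    index-injective {x} {y} eq = trans (sym (Inverse.strictlyInverseʳ card′ x))
      (trans (cong (Inverse.from card′) eq) (Inverse.strictlyInverseʳ card′ y))

    nonzero-pigeonhole : (v : Fin (suc N) → F) → (∀ i → v i ≢ 0#) →
      ∃₂ λ i j → toℕ i < toℕ j × v i ≡ v j
    nonzero-pigeonhole v v≢0 =
      let i , j , i<j , eq = Finₚ.pigeonhole (n<1+n N) slot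
      in i , j , i<j , index-injective (Finₚ.punchOut-injective (apart i) (apart j) eq)
      where
      apart : ∀ i → index 0# ≢ index (v i)
      apart i eq = v≢0 i (sym (index-injective eq))
      slot : Fin (suc N) → Fin N
      slot i = punchOut (apart i)

    powers-cover⇒N≤ : ∀ ω t → (∀ x → x ≢ 0# → ∃ λ i → i < t × x ≡ pow ω i) → N ≤ t
    powers-cover⇒N≤ ω t cover = Finₚ.injective⇒≤ exponent-injective
      where
      nonzero : Fin N → F
      nonzero k = Inverse.from card′ (punchIn (index 0#) k)
      index-nonzero : ∀ k → index (nonzero k) ≡ punchIn (index 0#) k
      index-nonzero k = Inverse.strictlyInverseˡ card′ _
      exponentOf : ∀ k → ∃ λ i → i < t × nonzero k ≡ pow ω i
      exponentOf k = cover (nonzero k) λ eq →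
        Finₚ.punchInᵢ≢i (index 0#) k (trans (sym (index-nonzero k)) (cong index eq))
      exponent : Fin N → Fin t
      exponent k = fromℕ< (proj₁ (proj₂ (exponentOf k)))
      exponent-injective : Injective _≡_ _≡_ exponent
      exponent-injective {k} {k′} eq = Finₚ.punchIn-injective (index 0#) k k′ (begin
        punchIn (index 0#) k  ≡⟨ sym (index-nonzero k) ⟩
        index (nonzero k)     ≡⟨ cong index same ⟩
        index (nonzero k′)    ≡⟨ index-nonzero k′ ⟩
        punchIn (index 0#) k′ ∎)
        where
        same : nonzero k ≡ nonzero k′
        same = trans (proj₂ (proj₂ (exponentOf k)))
          (trans (cong (pow ω) (Finₚ.fromℕ<-injective _ _ _ _ eq))
                 (sym (proj₂ (proj₂ (exponentOf k′)))))

    module Primitive (ω : F) (ω-primitive : ∀ x → x ≢ 0# → ∃ λ i → x ≡ pow ω i) where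

      -- needed because in a field with two elements ω = 0 satisfies the primitivity hypothesis
      1<N⇒ω≢0 : 1 < N → ω ≢ 0#
      1<N⇒ω≢0 1<N ω≡0 = <⇒≱ 1<N (powers-cover⇒N≤ ω 1 cover)
        where
        cover : ∀ x → x ≢ 0# → ∃ λ i → i < 1 × x ≡ pow ω i
        cover x x≢0 with ω-primitive x x≢0
        ... | zero  , x≡1    = 0 , z<s , x≡1
        ... | suc i , x≡ωⁱ⁺¹ =
          contradiction (trans x≡ωⁱ⁺¹ (trans (cong (λ y → pow y (suc i)) ω≡0) (pow-0# (suc i) z<s))) x≢0

      order-≥ : ∀ {t} → 0 < t → pow ω t ≡ 1# → N ≤ t
      order-≥ {t} t>0 ωᵗ≡1 = powers-cover⇒N≤ ω t cover
        where
        instance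
          t≢0 : NonZero t
          t≢0 = >-nonZero t>0
        cover : ∀ x → x ≢ 0# → ∃ λ i → i < t × x ≡ pow ω i
        cover x x≢0 =
          let i , x≡ωⁱ = ω-primitive x x≢0
          in i % t , m%n<n i t ,
             trans x≡ωⁱ (trans (cong (pow ω) (m≡m%n+[m/n]*n i t)) (pow-periodic ωᵗ≡1 (i % t) (i / t)))

      module _ (ω≢0 : ω ≢ 0#) where

        pow-N≡1 : pow ω N ≡ 1#
        pow-N≡1 with nonzero-pigeonhole (pow ω ∘ toℕ) (pow-nonzero ω≢0 ∘ toℕ)
        ... | i , j , i<j , eq = subst (λ n → pow ω n ≡ 1#) period≡N ωᵖ≡1
          where
          ωᵖ≡1 : pow ω (toℕ j ∸ toℕ i) ≡ 1#
          ωᵖ≡1 = pow-≡⇒pow-∸≡1 ω≢0 (<⇒≤ i<j) eq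
          period≡N : toℕ j ∸ toℕ i ≡ N
          period≡N = ≤-antisym (≤-trans (m∸n≤m _ (toℕ i)) (Finₚ.toℕ≤pred[n] j))
                               (order-≥ (m<n⇒0<n∸m i<j) ωᵖ≡1)

        pow-%N : {{_ : NonZero N}} → ∀ a → pow ω a ≡ pow ω (a % N)
        pow-%N a = trans (cong (pow ω) (m≡m%n+[m/n]*n a N)) (pow-periodic pow-N≡1 (a % N) (a / N))

        pow-injective-<N : ∀ {r r′} → r < r′ → r′ < N → pow ω r ≢ pow ω r′
        pow-injective-<N {r} {r′} r<r′ r′<N eq = <⇒≱ (≤-<-trans (m∸n≤m r′ r) r′<N)
          (order-≥ (m<n⇒0<n∸m r<r′) (pow-≡⇒pow-∸≡1 ω≢0 (<⇒≤ r<r′) eq))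

        pow-≡⇒≡mod : {{_ : NonZero N}} → ∀ a b → pow ω a ≡ pow ω b → a % N ≡ b % N
        pow-≡⇒≡mod a b ωᵃ≡ωᵇ with <-cmp (a % N) (b % N)
        ... | tri< lt _ _ = contradiction (trans (sym (pow-%N a)) (trans ωᵃ≡ωᵇ (pow-%N b)))
                              (pow-injective-<N lt (m%n<n b N))
        ... | tri≈ _ eq _ = eq
        ... | tri> _ _ gt = contradiction (trans (sym (pow-%N b)) (trans (sym ωᵃ≡ωᵇ) (pow-%N a)))
                              (pow-injective-<N gt (m%n<n a N))

module GammaLPowers {q : ℕ} (K : FiniteField q) (p : ℕ) (ω : FiniteField.F K) where

  open FiniteField K using (F; 0#; pow; isCommutativeRing) renaming (_*_ to _·_)
  open GammaL K p ω
  open FieldPowers K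
  open Algebra.Structures.IsCommutativeRing isCommutativeRing
    using () renaming (*-assoc to ·-assoc; *-identityʳ to ·-identityʳ; zeroˡ to ·-zeroˡ)

  iter-ω̂ : ∀ n x → iter ω̂ n x ≡ x · pow ω n
  iter-ω̂ zero    x = sym (·-identityʳ x)
  iter-ω̂ (suc n) x = trans (iter-ω̂ n (x · ω)) (·-assoc x ω _)

  iter-α : ∀ n x → iter α n x ≡ pow x (p ^ n)
  iter-α zero    x = sym (·-identityʳ x)
  iter-α (suc n) x = trans (iter-α n (pow x p)) (sym (pow-* x p (p ^ n)))

  gen₁-pow : ∀ d a → gen₁ d (pow ω a) ≡ pow ω (a + d)
  gen₁-pow d a = trans (iter-ω̂ d (pow ω a)) (sym (pow-+ ω a d))

  gen₂-pow : ∀ e s a → gen₂ e s (pow ω a) ≡ pow ω ((a + e) * p ^ s)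
  gen₂-pow e s a = trans (iter-α s _)
    (trans (cong (λ y → pow y (p ^ s)) (gen₁-pow e a)) (sym (pow-* ω (a + e) (p ^ s))))

  gen₁-0# : ∀ d → gen₁ d 0# ≡ 0#
  gen₁-0# d = trans (iter-ω̂ d 0#) (·-zeroˡ _)

  gen₂-0# : ∀ e s → 0 < p ^ s → gen₂ e s 0# ≡ 0#
  gen₂-0# e s p^s>0 = trans (iter-α s _)
    (trans (cong (λ y → pow y (p ^ s)) (gen₁-0# e)) (pow-0# (p ^ s) p^s>0))

module Transitivity {q N : ℕ} (K : FiniteField q) (q≡1+N : q ≡ suc N) {{_ : NonZero N}}
                    (p : ℕ) (ω : FiniteField.F K) (ω-primitive : GammaL.IsPrimitive K p ω)
                    (d e s : ℕ) {{_ : NonZero d}} (d∣N : d ∣ N)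
                    (1<p^s : 1 < p ^ s) (p^s-cancel : ∀ x → d ∣ x * p ^ s → d ∣ x) where

  open FiniteField K using (F; 0#; 1#; pow)
  open GammaL K p ω
  open FieldPowers K
  open Count q≡1+N
  open Primitive ω ω-primitive
  open GammaLPowers K p ω
  open AffineResidue d e p s 1<p^s p^s-cancel

  InOrbit : F → F → Set
  InOrbit = Orbit (gen₁ d) (gen₂ e s)

  gen₁-pow-+*d : ∀ c k → gen₁ d (pow ω (c + k * d)) ≡ pow ω (c + suc k * d)
  gen₁-pow-+*d c k = trans (gen₁-pow d (c + k * d))
    (cong (pow ω) (trans (+-assoc c (k * d) d) (cong (c +_) (+-comm (k * d) d))))

  orbit-+*d : ∀ {x} k c → InOrbit x (pow ω c) → InOrbit x (pow ω (c + k * d))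
  orbit-+*d zero    c o = subst (InOrbit _ ∘ pow ω) (sym (+-identityʳ c)) o
  orbit-+*d (suc k) c o =
    subst (InOrbit _) (gen₁-pow-+*d c k) (fwd₁ (orbit-+*d k c o))

  orbit-∸*d : ∀ {x} k c → InOrbit x (pow ω (c + k * d)) → InOrbit x (pow ω c)
  orbit-∸*d zero    c o = subst (InOrbit _ ∘ pow ω) (+-identityʳ c) o
  orbit-∸*d (suc k) c o =
    orbit-∸*d k c (bwd₁ (subst (InOrbit _) (sym (gen₁-pow-+*d c k)) o))

  orbit-≋ : ∀ {x a b} → a ≋ b → InOrbit x (pow ω a) → InOrbit x (pow ω b)
  orbit-≋ {x} {a} {b} a≋b o = subst (InOrbit x ∘ pow ω) (sym (m≡m%n+[m/n]*n b d))
    (orbit-+*d (b / d) (b % d) (subst (InOrbit x ∘ pow ω) a≋b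
      (orbit-∸*d (a / d) (a % d) (subst (InOrbit x ∘ pow ω) (m≡m%n+[m/n]*n a d) o))))

  orbit-affine : ∀ {x} n c → InOrbit x (pow ω c) → InOrbit x (pow ω (iter affine n c))
  orbit-affine zero    c o = o
  orbit-affine (suc n) c o = orbit-affine n (affine c) (subst (InOrbit _) (gen₂-pow e s c) (fwd₂ o))

  hits⇒inOrbit : ReturnsAt d → ∀ {a b i j} → i < d →
    iter affine i 0 ≋ a → iter affine j 0 ≋ b → InOrbit (pow ω a) (pow ω b)
  hits⇒inOrbit ret {a} {b} {i} {j} i<d hitᵢ hitⱼ =
    orbit-≋ (trans (iter-cong j ret) hitⱼ)
      (subst (InOrbit (pow ω a) ∘ pow ω) i+k≡d+j (orbit-affine k _ (orbit-≋ (sym hitᵢ) here)))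
    where
    k : ℕ
    k = d ∸ i + j
    i+k≡d+j : iter affine k (iter affine i 0) ≡ iter affine j (iter affine d 0)
    i+k≡d+j = trans (sym (iter-+ affine i k 0)) (trans
      (cong (λ n → iter affine n 0)
        (trans (sym (+-assoc i (d ∸ i) j)) (cong (_+ j) (m+[n∸m]≡n (<⇒≤ i<d)))))
      (iter-+ affine d j 0))

  firstReturnAt⇒transitive : FirstReturnAt d → TransitiveOnV* d e s
  firstReturnAt⇒transitive (ret , early) x y x≢0 y≢0 with ω-primitive x x≢0 | ω-primitive y y≢0
  ... | a , refl | b , refl with noEarlyReturn⇒hit early a | noEarlyReturn⇒hit early b
  ...   | i , i<d , hitᵢ | j , _ , hitⱼ = hits⇒inOrbit ret {i = i} {j} i<d hitᵢ hitⱼ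

  ExponentReachable : F → Set
  ExponentReachable y = ∃ λ a → y ≡ pow ω a × Reachable a

  module _ (ω≢0 : ω ≢ 0#) where

    pow-≡⇒≋ : ∀ a b → pow ω a ≡ pow ω b → a ≋ b
    pow-≡⇒≋ a b ωᵃ≡ωᵇ = trans (sym (m∣n⇒o%n%m≡o%m d N a d∣N))
      (trans (cong (_% d) (pow-≡⇒≡mod ω≢0 a b ωᵃ≡ωᵇ)) (m∣n⇒o%n%m≡o%m d N b d∣N))

    exponentReachable-step : ∀ {g : F → F} (φ : ℕ → ℕ) → (∀ a → g (pow ω a) ≡ pow ω (φ a)) →
      (∀ {a} → Reachable a → Reachable (φ a)) → ∀ {y} → ExponentReachable y → ExponentReachable (g y)
    exponentReachable-step φ g-pow step (a , refl , reach) = φ a , g-pow a , step reach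

    exponentReachable-unstep : ∀ {g : F → F} (φ : ℕ → ℕ) → g 0# ≡ 0# →
      (∀ a → g (pow ω a) ≡ pow ω (φ a)) → (∀ {a} → Reachable (φ a) → Reachable a) →
      ∀ {y} → ExponentReachable (g y) → ExponentReachable y
    exponentReachable-unstep {g} φ g0 g-pow unstep {y} (b , gy≡ωᵇ , reach)
      with ω-primitive y (λ y≡0 → pow-nonzero ω≢0 b (trans (sym gy≡ωᵇ) (trans (cong g y≡0) g0)))
    ... | a , refl =
      a , refl , unstep (reachable-resp (pow-≡⇒≋ b (φ a) (trans (sym gy≡ωᵇ) (g-pow a))) reach)

    orbit⇒exponentReachable : ∀ {y} → InOrbit 1# y → ExponentReachable y
    orbit⇒exponentReachable here     = 0 , refl , 0 , 0 , refl
    orbit⇒exponentReachable (fwd₁ o) = exponentReachable-step (_+ d) (gen₁-pow d)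
      (reachable-resp (sym ([m+n]%n≡m%n _ d))) (orbit⇒exponentReachable o)
    orbit⇒exponentReachable (fwd₂ o) = exponentReachable-step affine (gen₂-pow e s)
      reachable-step (orbit⇒exponentReachable o)
    orbit⇒exponentReachable (bwd₁ o) = exponentReachable-unstep (_+ d) (gen₁-0# d) (gen₁-pow d)
      (reachable-resp ([m+n]%n≡m%n _ d)) (orbit⇒exponentReachable o)
    orbit⇒exponentReachable (bwd₂ o) = exponentReachable-unstep affine (gen₂-0# e s (<-trans z<s 1<p^s))
      (gen₂-pow e s) reachable-unstep (orbit⇒exponentReachable o)

  transitive⇒allReachable : TransitiveOnV* d e s → ∀ c → Reachable c
  transitive⇒allReachable transitive c with d ≟ 1
  ... | yes d≡1 = 0 , 0 , d≡1⇒≋ d≡1 0 c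
  ... | no  d≢1 =
    let a , ωᶜ≡ωᵃ , reach =
          orbit⇒exponentReachable ω≢0 (transitive 1# (pow ω c) (pow-nonzero ω≢0 0) (pow-nonzero ω≢0 c))
    in reachable-resp (sym (pow-≡⇒≋ ω≢0 c a ωᶜ≡ωᵃ)) reach
    where
    ω≢0 : ω ≢ 0#
    ω≢0 = 1<N⇒ω≢0 (<-≤-trans (≤∧≢⇒< (>-nonZero⁻¹ d) (d≢1 ∘ sym)) (∣⇒≤ d∣N))

  transitive⇔firstReturnAt : TransitiveOnV* d e s ⇔ FirstReturnAt d
  transitive⇔firstReturnAt =
    mk⇔ (allReachable⇒firstReturnAt ∘ transitive⇒allReachable) firstReturnAt⇒transitive

lemma7p4 : (p R : ℕ) → Prime p → 1 ≤ R →
    (K : FiniteField (p ^ R)) → (ω : FiniteField.F K) → GammaL.IsPrimitive K p ω →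
    (d e s : ℕ) →
    -- standard form
    0 < d → d ∣ (p ^ R ∸ 1) →
    0 < s → s ∣ R →
    e < d → d ∣ (e * ((p ^ R ∸ 1) div (p ^ s ∸ 1))) →
    (GammaL.TransitiveOnV* K p ω d e s ⇔
      (d ≡ 1 ⊎
        ((0 < e × d ∣ (e * ((p ^ (d * s) ∸ 1) div (p ^ s ∸ 1))))
          × (∀ d′ → 1 < d′ → d′ < d → ¬ (d ∣ (e * ((p ^ (d′ * s) ∸ 1) div (p ^ s ∸ 1))))))))
lemma7p4 p R p-prime R≥1 K ω ω-primitive d e s d>0 d∣N s>0 s∣R e<d _ =
  ⇔.trans transitive⇔firstReturnAt (firstReturnAt⇔ e<d)
  where
  1<p : 1 < p
  1<p = nonTrivial⇒n>1 p {{prime⇒nonTrivial p-prime}}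
  instance
    d≢0 : NonZero d
    d≢0 = >-nonZero d>0
    R≢0 : NonZero R
    R≢0 = >-nonZero R≥1
    p≢0 : NonZero p
    p≢0 = >-nonZero (<-trans z<s 1<p)
    N≢0 : NonZero (p ^ R ∸ 1)
    N≢0 = >-nonZero (m<n⇒0<n∸m (^-monoʳ-< p 1<p R≥1))
  p^R≡1+N : p ^ R ≡ suc (p ^ R ∸ 1)
  p^R≡1+N = sym (m+[n∸m]≡n (m^n>0 p R))
  1<p^s : 1 < p ^ s
  1<p^s = ^-monoʳ-< p 1<p s>0
  p^s*p^[R∸s]≡1+N : p ^ s * p ^ (R ∸ s) ≡ suc (p ^ R ∸ 1)
  p^s*p^[R∸s]≡1+N =
    trans (sym (^-distribˡ-+-* p s (R ∸ s))) (trans (cong (p ^_) (m+[n∸m]≡n (∣⇒≤ s∣R))) p^R≡1+N)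
  p^s-cancel : ∀ x → d ∣ x * p ^ s → d ∣ x
  p^s-cancel x = unit-cancel d∣N p^s*p^[R∸s]≡1+N
  open Transitivity K p^R≡1+N p ω ω-primitive d e s d∣N 1<p^s p^s-cancel
    using (transitive⇔firstReturnAt)
  open AffineResidue d e p s 1<p^s p^s-cancel using (firstReturnAt⇔)
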